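{- Let $w=a^{n_1}b^{n_2}a$ or $w=ab^{n_2}a^{n_1}$, where $a\ne b$ are letters, $n_1\ge1$ and $n_2\in\{3,4\}$. Then all elements of $\mathtt{BR}(w)$ are rich.
   Context: $\mathtt{BR}(w)=\{B_t\cdots B_1 : w=B_1\cdots B_t,\ t\ge1,\ B_i \text{ non-empty}\}$. A word $w$ is rich if it has exactly $|w|$ distinct non-empty palindromic factors. -}

module Defs where

open import Level using (Level)
open import Data.Nat using (ℕ; suc; _≥_)
open import Data.List using (List; []; _∷_; _++_; length; reverse; concat; replicate)
open import Data.List.Relation.Unary.All using (All)
open import Data.List.Relation.Unary.Unique.Propositional using (Unique)
open import Data.List.Membership.Propositional using (_∈_)
open import Data.Product using (Σ; ∃; _×_; _,_)
open import Relation.Binary.PropositionalEquality using (_≡_; _≢_)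

private variable ℓ : Level

Word : Set ℓ → Set ℓ
Word A = List A

NonEmpty : {A : Set ℓ} → Word A → Set ℓ
NonEmpty {A = A} u = Σ A λ x → Σ (List A) λ xs → u ≡ x ∷ xs

Factor : {A : Set ℓ} → Word A → Word A → Set ℓ
Factor {A = A} u w = Σ (List A) λ p → Σ (List A) λ s → p ++ u ++ s ≡ w

Palindrome : {A : Set ℓ} → Word A → Set ℓ
Palindrome u = reverse u ≡ u

PalFactor : {A : Set ℓ} → Word A → Word A → Set ℓ
PalFactor w u = NonEmpty u × Palindrome u × Factor u w

Rich : {A : Set ℓ} → Word A → Set ℓ
Rich {A = A} w = Σ (List (Word A)) λ L →
  Unique L × All (PalFactor w) L × (∀ u → PalFactor w u → u ∈ L) × length L ≡ length w

InBR : {A : Set ℓ} → Word A → Word A → Set ℓ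
InBR {A = A} w v = Σ (List (Word A)) λ Bs →
  length Bs ≥ 1 × All NonEmpty Bs × concat Bs ≡ w × concat (reverse Bs) ≡ v

-- The second word is the reverse of the first, and reversal commutes with BR and preserves
-- richness; a two-letter alphabet suffices.  Splitting off the first block shows that every
-- element of BR(a^n b^M a) reads P a^j b^k a^e with P = b^s or b^s a b^t, k ≥ 1 and
-- s + t + k = M, so for M ∈ {3, 4} it is enough that a^X b^k a^Y T is rich for every X, Y and
-- each of the finitely many pairs (k, T = P reversed).
--
-- Appending a letter creates at most one new palindromic factor, so a word is rich iff each of
-- its prefixes ends in a palindrome that does not occur earlier; suffixes of rich words are rich,
-- so we may assume X > Y.  Whether a word u occurs in a word containing a run of at least |u|
-- a's does not depend on the length of that run; for Y ≤ 4 this reduces all X to a finite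
-- computation along T.  For Y ≥ 5 the palindrome completed by each letter of T either has length
-- at most 5, and the same argument applies to both runs, or it is centred in the run a^Y and is
-- absent before because the prefix has fewer b's, fewer runs of b's, or a shorter final run of
-- a's, counts which do not depend on X and Y.

module Submission where

open import Defs
open import Data.Bool using (Bool; true; false; T; not; _∧_; _∨_)
open import Data.Bool.Properties using (T-∧; T-∨) renaming (_≟_ to _≟ᵇ_)
open import Data.Nat using (ℕ; zero; suc; _+_; _∸_; _≤_; _<_; _≥_; z≤n; s≤s; _≤ᵇ_; _<ᵇ_; _≡ᵇ_)
open import Data.Nat.Properties
  using (≤-refl; ≤-trans; ≤-reflexive; ≤-antisym; ≤-pred; <-irrefl; <-cmp; <⇒≤; <⇒≢; <⇒≱; 1+n≰n; n≤1+n; _≤?_; ≰⇒>;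
         m≤m+n; m≤n+m; m≤n⇒m<n∨m≡n; n≤0⇒n≡0; suc-injective; +-comm; +-assoc; +-suc; +-identityʳ; +-cancelˡ-≤;
         +-monoʳ-≤; +-monoˡ-≤; m∸n+n≡m; ≤ᵇ⇒≤; <ᵇ⇒<; ≡ᵇ⇒≡; ≡⇒≡ᵇ; module ≤-Reasoning)
open import Data.List using (List; []; _∷_; [_]; _++_; _∷ʳ_; length; reverse; replicate; concat; map; filter)
open import Data.List.Properties
  using (++-assoc; ++-identityʳ; ++-cancelˡ; ++-conicalˡ; ++-conicalʳ; ∷ʳ-++; ∷-injective; ∷-injectiveˡ; ∷-injectiveʳ; ≡-dec;
         reverse-++; reverse-involutive; unfold-reverse; reverse-map; concat-++; concat-map; map-++; map-replicate;
         map-injective; length-map; length-++; length-reverse; length-replicate; length-++-≤ˡ; length-++-≤ʳ)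
open import Data.List.Relation.Unary.All as All using (All; []; _∷_)
open import Data.List.Relation.Unary.All.Properties
  using (all-filter; ¬Any⇒All¬) renaming (filter⁺ to All-filter⁺; map⁺ to All-map⁺; map⁻ to All-map⁻)
open import Data.List.Relation.Unary.Any.Properties using (reverse⁻)
open import Data.List.Relation.Unary.AllPairs using ([]; _∷_)
open import Data.List.Relation.Unary.Unique.Propositional using (Unique)
open import Data.List.Relation.Unary.Unique.Propositional.Properties
  using () renaming (filter⁺ to Unique-filter⁺; map⁺ to Unique-map⁺)
open import Data.List.Membership.Propositional using (_∈_)
open import Data.List.Membership.Propositional.Properties using (∈-map⁺)
open import Data.Product using (Σ; _×_; _,_) renaming (map₂ to Σ-map₂)
open import Data.Sum using (_⊎_; inj₁; inj₂)
open import Data.Empty using (⊥-elim)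
open import Data.Unit using (tt)
open import Function using (_∘_; Injective)
open import Function.Bundles using (module Equivalence)
open import Relation.Binary using (DecidableEquality; tri<; tri≈; tri>)
open import Relation.Nullary using (¬_; Dec; yes; no; does; isYes; contradiction; map′)
open import Relation.Nullary.Decidable using (toWitness; toWitnessFalse)
open import Relation.Unary using (Decidable)
open import Relation.Unary.Properties using (∁?)
open import Relation.Binary.PropositionalEquality hiding ([_])
open Equivalence using (to)

module _ {A : Set} where
  open ≡-Reasoning

  Prefix Suffix : Word A → Word A → Set
  Prefix u w = Σ (Word A) λ s → u ++ s ≡ w
  Suffix u w = Σ (Word A) λ h → h ++ u ≡ w

  PalSuffix : Word A → Word A → Set
  PalSuffix u w = NonEmpty u × Palindrome u × Suffix u w

  replicate-+ : ∀ (c : A) m n z → replicate m c ++ replicate n c ++ z ≡ replicate (m + n) c ++ z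
  replicate-+ c zero    n z = refl
  replicate-+ c (suc m) n z = cong (c ∷_) (replicate-+ c m n z)

  replicate-comm : ∀ (c : A) n z → replicate n c ++ c ∷ z ≡ c ∷ replicate n c ++ z
  replicate-comm c zero    z = refl
  replicate-comm c (suc n) z = cong (c ∷_) (replicate-comm c n z)

  replicate-++ : ∀ (c : A) m n → replicate m c ++ replicate n c ≡ replicate (m + n) c
  replicate-++ c zero    n = refl
  replicate-++ c (suc m) n = cong (c ∷_) (replicate-++ c m n)

  replicate-swap : ∀ (c : A) m n z → replicate m c ++ replicate n c ++ z ≡ replicate n c ++ replicate m c ++ z
  replicate-swap c m n z = begin
    replicate m c ++ replicate n c ++ z  ≡⟨ replicate-+ c m n z ⟩
    replicate (m + n) c ++ z             ≡⟨ cong (λ k → replicate k c ++ z) (+-comm m n) ⟩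
    replicate (n + m) c ++ z             ≡⟨ sym (replicate-+ c n m z) ⟩
    replicate n c ++ replicate m c ++ z  ∎

  replicate-∷ʳ : ∀ (c : A) n → replicate n c ∷ʳ c ≡ replicate (suc n) c
  replicate-∷ʳ c n = trans (replicate-comm c n []) (cong (c ∷_) (++-identityʳ _))

  reverse-replicate : ∀ (c : A) n → reverse (replicate n c) ≡ replicate n c
  reverse-replicate c zero    = refl
  reverse-replicate c (suc n) = begin
    reverse (c ∷ replicate n c)   ≡⟨ unfold-reverse c (replicate n c) ⟩
    reverse (replicate n c) ∷ʳ c  ≡⟨ cong (_∷ʳ c) (reverse-replicate c n) ⟩
    replicate n c ∷ʳ c            ≡⟨ replicate-∷ʳ c n ⟩
    c ∷ replicate n c             ∎

  ++-assoc₃ : ∀ (x y z w : Word A) → (x ++ y ++ z) ++ w ≡ x ++ y ++ z ++ w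
  ++-assoc₃ x y z w = trans (++-assoc x (y ++ z) w) (cong (x ++_) (++-assoc y z w))

  ++-replicate-split : ∀ (c : A) n (x y z : Word A) → x ++ y ≡ replicate n c ++ z →
    (Σ ℕ λ i → Σ ℕ λ r → i + r ≡ n × x ≡ replicate i c × y ≡ replicate r c ++ z) ⊎
    (Σ (Word A) λ x′ → x ≡ replicate n c ++ x′ × x′ ++ y ≡ z)
  ++-replicate-split c zero    x       y z eq = inj₂ (x , refl , eq)
  ++-replicate-split c (suc n) []      y z eq = inj₁ (0 , suc n , refl , refl , eq)
  ++-replicate-split c (suc n) (x ∷ xs) y z eq with ∷-injective eq
  ... | refl , eq′ with ++-replicate-split c n xs y z eq′
  ...   | inj₁ (i , r , i+r , refl , refl) = inj₁ (suc i , r , cong suc i+r , refl , refl)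
  ...   | inj₂ (x′ , refl , eq″)          = inj₂ (x′ , refl , eq″)

  reverse-++₃ : ∀ (xs ys zs : Word A) → reverse (xs ++ ys ++ zs) ≡ reverse zs ++ reverse ys ++ reverse xs
  reverse-++₃ xs ys zs = begin
    reverse (xs ++ ys ++ zs)                 ≡⟨ reverse-++ xs _ ⟩
    reverse (ys ++ zs) ++ reverse xs         ≡⟨ cong (_++ reverse xs) (reverse-++ ys zs) ⟩
    (reverse zs ++ reverse ys) ++ reverse xs ≡⟨ ++-assoc (reverse zs) _ _ ⟩
    reverse zs ++ reverse ys ++ reverse xs   ∎

  palindrome-wrap : ∀ (c m : Word A) → Palindrome m → Palindrome (reverse c ++ m ++ c)
  palindrome-wrap c m pal-m = begin
    reverse (reverse c ++ m ++ c)                  ≡⟨ reverse-++₃ (reverse c) m c ⟩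
    reverse c ++ reverse m ++ reverse (reverse c)  ≡⟨ cong₂ (λ x y → reverse c ++ x ++ y) pal-m (reverse-involutive c) ⟩
    reverse c ++ m ++ c                            ∎

  Suffix-++ˡ : ∀ p {u w : Word A} → Suffix u w → Suffix u (p ++ w)
  Suffix-++ˡ p {u} (h , eq) = p ++ h , trans (++-assoc p h u) (cong (p ++_) eq)

  PalSuffix-++ˡ : ∀ p {u w : Word A} → PalSuffix u w → PalSuffix u (p ++ w)
  PalSuffix-++ˡ p = Σ-map₂ (Σ-map₂ (Suffix-++ˡ p))

  Factor-length : ∀ {u w : Word A} → Factor u w → length u ≤ length w
  Factor-length {u} (p , s , refl) = ≤-trans (length-++-≤ˡ u) (length-++-≤ʳ (u ++ s) {p})

  Factor-reverse : ∀ {u w : Word A} → Factor u w → Factor (reverse u) (reverse w)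
  Factor-reverse {u} (p , s , refl) = reverse s , reverse p , sym (reverse-++₃ p u s)

  PalFactor-reverse⁻ : ∀ {w u : Word A} → PalFactor (reverse w) u → PalFactor w u
  PalFactor-reverse⁻ {w} (ne , pal , fac) = ne , pal , subst₂ Factor pal (reverse-involutive w) (Factor-reverse fac)

  PalFactor-reverse⁺ : ∀ {w u : Word A} → PalFactor w u → PalFactor (reverse w) u
  PalFactor-reverse⁺ (ne , pal , fac) = ne , pal , subst (λ z → Factor z _) pal (Factor-reverse fac)

  Rich-reverse : ∀ (v : Word A) → Rich (reverse v) → Rich v
  Rich-reverse v (L , uniq , pals , complete , len) =
    L , uniq , All.map PalFactor-reverse⁻ pals , (λ u → complete u ∘ PalFactor-reverse⁺) , trans len (length-reverse v)

  NonEmpty-reverse : ∀ {u : Word A} → NonEmpty u → NonEmpty (reverse u)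
  NonEmpty-reverse (x , xs , refl) = subst NonEmpty (sym (unfold-reverse x xs)) (snoc-nonEmpty (reverse xs))
    where
    snoc-nonEmpty : ∀ ys → NonEmpty (ys ∷ʳ x)
    snoc-nonEmpty []       = x , [] , refl
    snoc-nonEmpty (y ∷ ys) = y , ys ∷ʳ x , refl

  reverse-concat : ∀ (xss : List (Word A)) → reverse (concat xss) ≡ concat (reverse (map reverse xss))
  reverse-concat []         = refl
  reverse-concat (xs ∷ xss) = begin
    reverse (xs ++ concat xss)                                ≡⟨ reverse-++ xs _ ⟩
    reverse (concat xss) ++ reverse xs                        ≡⟨ cong (_++ reverse xs) (reverse-concat xss) ⟩
    concat (reverse (map reverse xss)) ++ reverse xs          ≡⟨ cong (concat (reverse (map reverse xss)) ++_) (sym (++-identityʳ _)) ⟩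
    concat (reverse (map reverse xss)) ++ concat [ reverse xs ] ≡⟨ concat-++ (reverse (map reverse xss)) _ ⟩
    concat (reverse (map reverse xss) ∷ʳ reverse xs)          ≡⟨ cong concat (sym (unfold-reverse (reverse xs) (map reverse xss))) ⟩
    concat (reverse (map reverse (xs ∷ xss)))                 ∎

  InBR-reverse : ∀ {w v : Word A} → InBR (reverse w) v → InBR w (reverse v)
  InBR-reverse {w} {v} (Bs , t≥1 , nonEmpty , concat≡ , refl) =
    reverse (map reverse Bs) ,
    subst (_≥ 1) (sym (trans (length-reverse (map reverse Bs)) (length-map reverse Bs))) t≥1 ,
    All.tabulate (λ B∈ → All.lookup (All-map⁺ (All.map NonEmpty-reverse nonEmpty)) (reverse⁻ B∈)) ,
    trans (sym (reverse-concat Bs)) (trans (cong reverse concat≡) (reverse-involutive w)) ,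
    concat-of-reversed
    where
    concat-of-reversed : concat (reverse (reverse (map reverse Bs))) ≡ reverse (concat (reverse Bs))
    concat-of-reversed = begin
      concat (reverse (reverse (map reverse Bs)))   ≡⟨ cong concat (reverse-involutive (map reverse Bs)) ⟩
      concat (map reverse Bs)                       ≡⟨ cong (concat ∘ map reverse) (sym (reverse-involutive Bs)) ⟩
      concat (map reverse (reverse (reverse Bs)))   ≡⟨ cong concat (reverse-map reverse (reverse Bs)) ⟩
      concat (reverse (map reverse (reverse Bs)))   ≡⟨ sym (reverse-concat (reverse Bs)) ⟩
      reverse (concat (reverse Bs))                 ∎

module _ {B A : Set} (f : B → A) where

  map-++-split : ∀ (x y : Word A) (w : Word B) → x ++ y ≡ map f w →
    Σ (Word B) λ w₁ → Σ (Word B) λ w₂ → w ≡ w₁ ++ w₂ × x ≡ map f w₁ × y ≡ map f w₂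
  map-++-split []      y w       eq = [] , w , refl , refl , eq
  map-++-split (c ∷ x) y (d ∷ w) eq with map-++-split x y w (∷-injectiveʳ eq)
  ... | w₁ , w₂ , refl , refl , refl = d ∷ w₁ , w₂ , refl , cong (_∷ map f w₁) (∷-injectiveˡ eq) , refl

  concat-map-split : ∀ (Bs : List (Word A)) (w : Word B) → concat Bs ≡ map f w →
    Σ (List (Word B)) λ Cs → Bs ≡ map (map f) Cs × concat Cs ≡ w
  concat-map-split []       []      eq = [] , refl , refl
  concat-map-split (B ∷ Bs) w       eq with map-++-split B (concat Bs) w eq
  ... | w₁ , w₂ , refl , refl , eq′ with concat-map-split Bs w₂ eq′
  ...   | Cs , refl , refl = w₁ ∷ Cs , refl , refl

  NonEmpty-map⁻ : ∀ {u : Word B} → NonEmpty (map f u) → NonEmpty u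
  NonEmpty-map⁻ {x ∷ xs} _ = x , xs , refl

  InBR-map⁻ : ∀ (w : Word B) (v : Word A) → InBR (map f w) v → Σ (Word B) λ v′ → v ≡ map f v′ × InBR w v′
  InBR-map⁻ w v (Bs , t≥1 , nonEmpty , eq , refl) with concat-map-split Bs w eq
  ... | Cs , refl , refl =
    concat (reverse Cs) ,
    trans (cong concat (sym (reverse-map (map f) Cs))) (concat-map (reverse Cs)) ,
    Cs , subst (_≥ 1) (length-map (map f) Cs) t≥1 , All.map NonEmpty-map⁻ (All-map⁻ nonEmpty) , refl , refl

  Factor-map : ∀ {u w : Word B} → Factor u w → Factor (map f u) (map f w)
  Factor-map {u} (p , s , refl) = map f p , map f s , trans (cong (map f p ++_) (sym (map-++ f u s))) (sym (map-++ f p _))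

  PalFactor-map : ∀ {w u : Word B} → PalFactor w u → PalFactor (map f w) (map f u)
  PalFactor-map {u = x ∷ xs} (_ , pal , fac) =
    (f x , map f xs , refl) , trans (sym (reverse-map f (x ∷ xs))) (cong (map f) pal) , Factor-map fac

  module _ (f-inj : Injective _≡_ _≡_ f) where

    PalFactor-map⁻ : ∀ {w : Word B} {u : Word A} → PalFactor (map f w) u → Σ (Word B) λ u′ → u ≡ map f u′ × PalFactor w u′
    PalFactor-map⁻ {w} (ne , pal , (p , s , eq)) with map-++-split p _ w eq
    ... | w₁ , w₂ , refl , refl , eq′ with map-++-split _ s w₂ eq′
    ...   | u′ , w₄ , refl , refl , refl =
      u′ , refl , NonEmpty-map⁻ ne , map-injective f-inj (trans (reverse-map f u′) pal) , w₁ , w₄ , refl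

    Rich-map : ∀ (v : Word B) → Rich v → Rich (map f v)
    Rich-map v (L , uniq , pals , complete , len) =
      map (map f) L , Unique-map⁺ (map-injective f-inj) uniq , All-map⁺ (All.map PalFactor-map pals) ,
      complete′ , trans (length-map _ L) (trans len (sym (length-map f v)))
      where
      complete′ : ∀ u → PalFactor (map f v) u → u ∈ map (map f) L
      complete′ u pf with PalFactor-map⁻ pf
      ... | u′ , refl , pf′ = ∈-map⁺ (map f) (complete u′ pf′)

-- Counting palindromic factors

length-filter-∁ : ∀ {X : Set} {P : X → Set} (P? : Decidable P) xs →
  length xs ≡ length (filter P? xs) + length (filter (∁? P?) xs)
length-filter-∁ P? []       = refl
length-filter-∁ P? (x ∷ xs) with does (P? x)
... | true  = cong suc (length-filter-∁ P? xs)
... | false = trans (cong suc (length-filter-∁ P? xs)) (sym (+-suc _ _))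

Unique-length≤1 : ∀ {X : Set} {P : X → Set} {xs} → Unique xs → All P xs → (∀ {x y} → P x → P y → x ≡ y) → length xs ≤ 1
Unique-length≤1 {xs = []}    _ _ _ = z≤n
Unique-length≤1 {xs = _ ∷ []} _ _ _ = s≤s z≤n
Unique-length≤1 {xs = _ ∷ _ ∷ _} ((x≢y ∷ _) ∷ _) (px ∷ py ∷ _) all-equal = ⊥-elim (x≢y (all-equal px py))

module _ {A : Set} where
  open ≡-Reasoning

  RichWitness : Word A → Set
  RichWitness w = Σ (List (Word A)) λ L → Unique L × All (PalFactor w) L × length L ≡ length w

  RichWitness-reverse : ∀ w → RichWitness (reverse w) → RichWitness w
  RichWitness-reverse w (L , uniq , pals , len) = L , uniq , All.map PalFactor-reverse⁻ pals , trans len (length-reverse w)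

  Factor-∷ʳ : ∀ {u p : Word A} x → Factor u p → Factor u (p ∷ʳ x)
  Factor-∷ʳ {u} x (q , s , refl) = q , s ∷ʳ x , sym (trans (++-assoc q (u ++ s) [ x ]) (cong (q ++_) (++-assoc u s [ x ])))

  Suffix⇒Factor : ∀ {u w : Word A} → Suffix u w → Factor u w
  Suffix⇒Factor {u} (h , eq) = h , [] , trans (cong (h ++_) (++-identityʳ u)) eq

  RichWitness-∷ʳ : ∀ {p u : Word A} x → RichWitness p → PalSuffix u (p ∷ʳ x) → ¬ Factor u p → RichWitness (p ∷ʳ x)
  RichWitness-∷ʳ {p} x (L , uniq , pals , len) (ne , pal , suf) new =
    _ ∷ L ,
    All.map (λ { (_ , _ , fac) refl → new fac }) pals ∷ uniq ,
    (ne , pal , Suffix⇒Factor suf) ∷ All.map (λ (ne′ , pal′ , fac) → ne′ , pal′ , Factor-∷ʳ x fac) pals ,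
    trans (cong suc len) (sym (trans (length-++ p) (+-comm (length p) 1)))

  new-factor-is-prefix : ∀ {x : A} {u w} → Factor u (x ∷ w) → ¬ Factor u w → Prefix u (x ∷ w)
  new-factor-is-prefix ([]    , s , eq) _   = s , eq
  new-factor-is-prefix (_ ∷ p , s , eq) new = ⊥-elim (new (p , s , ∷-injectiveʳ eq))

  prefix-compare : ∀ (u s v t : Word A) → u ++ s ≡ v ++ t → length u ≤ length v → Prefix u v
  prefix-compare []      s v       t eq le       = v , refl
  prefix-compare (x ∷ u) s (y ∷ v) t eq (s≤s le) with ∷-injective eq
  ... | refl , eq′ with prefix-compare u s v t eq′ le
  ...   | d , refl = d , refl

  prefix-same-length : ∀ (u s v t : Word A) → u ++ s ≡ v ++ t → length u ≡ length v → u ≡ v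
  prefix-same-length []      s []      t _  _   = refl
  prefix-same-length (x ∷ u) s (y ∷ v) t eq len with ∷-injective eq
  ... | refl , eq′ = cong (x ∷_) (prefix-same-length u s v t eq′ (suc-injective len))

  Factor-drop-run-letter : ∀ {u : Word A} c x n z → length u ≤ n →
    Factor u (x ++ c ∷ replicate n c ++ z) → Factor u (x ++ replicate n c ++ z)
  Factor-drop-run-letter {u} c x n z |u|≤n (q , s , eq) with length q ≤? length x
  ... | yes q≤x with prefix-compare q (u ++ s) x _ eq q≤x
  ...   | x₁ , refl with prefix-compare u s (x₁ ++ replicate n c) (c ∷ z) in-run
                           (≤-trans |u|≤n (≤-trans (≤-reflexive (sym (length-replicate n))) (length-++-≤ʳ _ {x₁})))
    where
    in-run : u ++ s ≡ (x₁ ++ replicate n c) ++ c ∷ z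
    in-run = begin
      u ++ s                             ≡⟨ ++-cancelˡ q _ _ (trans eq (++-assoc q x₁ _)) ⟩
      x₁ ++ c ∷ replicate n c ++ z       ≡⟨ cong (x₁ ++_) (sym (replicate-comm c n z)) ⟩
      x₁ ++ replicate n c ++ c ∷ z       ≡⟨ sym (++-assoc x₁ _ _) ⟩
      (x₁ ++ replicate n c) ++ c ∷ z     ∎
  ...     | t , u++t = q , t ++ z , (begin
      q ++ u ++ t ++ z                   ≡⟨ cong (q ++_) (sym (++-assoc u t z)) ⟩
      q ++ (u ++ t) ++ z                 ≡⟨ cong (λ y → q ++ y ++ z) u++t ⟩
      q ++ (x₁ ++ replicate n c) ++ z    ≡⟨ cong (q ++_) (++-assoc x₁ _ z) ⟩
      q ++ x₁ ++ replicate n c ++ z      ≡⟨ sym (++-assoc q x₁ _) ⟩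
      (q ++ x₁) ++ replicate n c ++ z    ∎)
  Factor-drop-run-letter {u} c x n z |u|≤n (q , s , eq) | no q≰x
    with prefix-compare x _ q (u ++ s) (sym eq) (<⇒≤ (≰⇒> q≰x))
  ... | d , refl with d | ++-cancelˡ x _ _ (trans (sym (++-assoc x d _)) eq)
  ...   | []     | _   = ⊥-elim (q≰x (≤-reflexive (cong length (++-identityʳ x))))
  ...   | _ ∷ d′ | eq′ = x ++ d′ , s , trans (++-assoc x d′ _) (cong (x ++_) (∷-injectiveʳ eq′))

  Factor-shorten-run : ∀ {u : Word A} c x k m z → length u ≤ m →
    Factor u (x ++ replicate (k + m) c ++ z) → Factor u (x ++ replicate m c ++ z)
  Factor-shorten-run c x zero    m z _  fac = fac
  Factor-shorten-run c x (suc k) m z le fac =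
    Factor-shorten-run c x k m z le (Factor-drop-run-letter c x (k + m) z (≤-trans le (m≤n+m m k)) fac)

  -- A palindromic prefix u of a longer palindromic prefix v is also a suffix of v,
  -- so it occurs again after the first letter.
  shorter-palPrefix-recurs : ∀ {x : A} {w u v} → Palindrome u → Palindrome v →
    Prefix u (x ∷ w) → Prefix v (x ∷ w) → length u < length v → Factor u w
  shorter-palPrefix-recurs {x} {w} {u} {v} pal-u pal-v (s , u++s) (t , v++t) lt
    with prefix-compare u s v t (trans u++s (sym v++t)) (<⇒≤ lt)
  ... | d , refl = recurs (reverse d) (length-reverse d) rotated
    where
    rotated : u ++ d ≡ reverse d ++ u
    rotated = begin
      u ++ d                   ≡⟨ sym pal-v ⟩
      reverse (u ++ d)         ≡⟨ reverse-++ u d ⟩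
      reverse d ++ reverse u   ≡⟨ cong (reverse d ++_) pal-u ⟩
      reverse d ++ u           ∎
    recurs : ∀ r → length r ≡ length d → u ++ d ≡ r ++ u → Factor u w
    recurs []      len _  = ⊥-elim (<⇒≢ lt (sym (trans (length-++ u) (trans (cong (length u +_) (sym len)) (+-identityʳ _)))))
    recurs (c ∷ e) _   eq = e , t , trans (sym (++-assoc e u t)) (∷-injectiveʳ (trans (cong (_++ t) (sym eq)) v++t))

  new-palFactors-equal : ∀ {x : A} {w u v} → PalFactor (x ∷ w) u → PalFactor (x ∷ w) v →
    ¬ Factor u w → ¬ Factor v w → u ≡ v
  new-palFactors-equal {u = u} {v} (_ , pal-u , fac-u) (_ , pal-v , fac-v) new-u new-v
    with new-factor-is-prefix fac-u new-u | new-factor-is-prefix fac-v new-v | <-cmp (length u) (length v)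
  ... | pu | pv | tri< lt _ _ = ⊥-elim (new-u (shorter-palPrefix-recurs pal-u pal-v pu pv lt))
  ... | pu | pv | tri> _ _ gt = ⊥-elim (new-v (shorter-palPrefix-recurs pal-v pal-u pv pu gt))
  ... | s , eu | t , ev | tri≈ _ len _ = prefix-same-length u s v t (trans eu (sym ev)) len

  ¬PalFactor[] : ∀ {u : Word A} → ¬ PalFactor [] u
  ¬PalFactor[] ((_ , _ , refl) , _ , ([]    , _ , ()))
  ¬PalFactor[] ((_ , _ , refl) , _ , (_ ∷ _ , _ , ()))

  module _ (_≟_ : DecidableEquality A) where

    prefix? : (u w : Word A) → Dec (Prefix u w)
    prefix? []      w       = yes (w , refl)
    prefix? (x ∷ u) []      = no λ ()
    prefix? (x ∷ u) (y ∷ w) with x ≟ y | prefix? u w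
    ... | yes refl | yes (s , eq) = yes (s , cong (x ∷_) eq)
    ... | yes refl | no ¬pre      = no λ (s , eq) → ¬pre (s , ∷-injectiveʳ eq)
    ... | no x≢y   | _            = no λ (_ , eq) → x≢y (∷-injectiveˡ eq)

    factor? : (u w : Word A) → Dec (Factor u w)
    factor? u w with prefix? u w
    ... | yes (s , eq) = yes ([] , s , eq)
    factor? u []      | no ¬pre = no λ { ([] , s , eq) → ¬pre (s , eq) ; (_ ∷ _ , _ , ()) }
    factor? u (y ∷ w) | no ¬pre with factor? u w
    ... | yes (p , s , eq) = yes (y ∷ p , s , cong (y ∷_) eq)
    ... | no ¬fac          = no λ { ([] , s , eq) → ¬pre (s , eq) ; (_ ∷ p , s , eq) → ¬fac (p , s , ∷-injectiveʳ eq) }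

    suffix? : (u w : Word A) → Dec (Suffix u w)
    suffix? u []      = map′ ([] ,_) (λ { ([] , eq) → eq ; (_ ∷ _ , ()) }) (≡-dec _≟_ u [])
    suffix? u (c ∷ w) with ≡-dec _≟_ u (c ∷ w) | suffix? u w
    ... | yes eq  | _            = yes ([] , eq)
    ... | no _    | yes (h , eq) = yes (c ∷ h , cong (c ∷_) eq)
    ... | no ¬eq  | no ¬suf      = no λ { ([] , eq) → ¬eq eq ; (_ ∷ h , eq) → ¬suf (h , ∷-injectiveʳ eq) }

    palindrome? : (w : Word A) → Dec (Palindrome w)
    palindrome? w = ≡-dec _≟_ (reverse w) w

    longestPalSuffix : Word A → Word A
    longestPalSuffix []      = []
    longestPalSuffix (x ∷ w) with palindrome? (x ∷ w)
    ... | yes _ = x ∷ w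
    ... | no  _ = longestPalSuffix w

    longestPalSuffix-∷ : ∀ x w → PalSuffix (longestPalSuffix (x ∷ w)) (x ∷ w)
    longestPalSuffix-∷ x w with palindrome? (x ∷ w)
    longestPalSuffix-∷ x w       | yes pal  = (x , w , refl) , pal , ([] , refl)
    longestPalSuffix-∷ x []      | no ¬pal  = ⊥-elim (¬pal refl)
    longestPalSuffix-∷ x (y ∷ w) | no _     = PalSuffix-++ˡ [ x ] (longestPalSuffix-∷ y w)

    longestPalSuffix-∷ʳ : ∀ w x → PalSuffix (longestPalSuffix (w ∷ʳ x)) (w ∷ʳ x)
    longestPalSuffix-∷ʳ []      x = longestPalSuffix-∷ x []
    longestPalSuffix-∷ʳ (y ∷ w) x = longestPalSuffix-∷ y (w ∷ʳ x)

    -- Palindromic factors of x ∷ w either occur in w or are the unique new one.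
    palFactors-∷ : ∀ {x : A} {w L} → Unique L → All (PalFactor (x ∷ w)) L →
      Σ (List (Word A)) λ L′ → Unique L′ × All (PalFactor w) L′ × length L ≤ suc (length L′)
    palFactors-∷ {x} {w} {L} uniq pals = old , Unique-filter⁺ occurs? uniq , old-pals , bound
      where
      occurs? : Decidable (λ u → Factor u w)
      occurs? u = factor? u w
      old = filter occurs? L
      new = filter (∁? occurs?) L
      old-pals : All (PalFactor w) old
      old-pals = All.zipWith (λ ((ne , pal , _) , fac) → ne , pal , fac) (All-filter⁺ occurs? pals , all-filter occurs? L)
      new-length : length new ≤ 1
      new-length = Unique-length≤1 (Unique-filter⁺ (∁? occurs?) uniq) (All.zip (All-filter⁺ (∁? occurs?) pals , all-filter (∁? occurs?) L))
                     (λ (pf-u , new-u) (pf-v , new-v) → new-palFactors-equal pf-u pf-v new-u new-v)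
      bound : length L ≤ suc (length old)
      bound = ≤-trans (≤-reflexive (length-filter-∁ occurs? L))
                (≤-trans (+-monoʳ-≤ (length old) new-length) (≤-reflexive (+-comm (length old) 1)))

    palFactors-bound : ∀ w {L} → Unique L → All (PalFactor w) L → length L ≤ length w
    palFactors-bound []      {[]}    _    _          = z≤n
    palFactors-bound []      {_ ∷ _} _    (pf ∷ _)   = ⊥-elim (¬PalFactor[] pf)
    palFactors-bound (x ∷ w)         uniq pals with palFactors-∷ uniq pals
    ... | L′ , uniq′ , pals′ , bound = ≤-trans bound (s≤s (palFactors-bound w uniq′ pals′))

    RichWitness-∷⁻ : ∀ {x : A} {w} → RichWitness (x ∷ w) → RichWitness w
    RichWitness-∷⁻ {w = w} (L , uniq , pals , len) with palFactors-∷ uniq pals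
    ... | L′ , uniq′ , pals′ , bound =
      L′ , uniq′ , pals′ , ≤-antisym (palFactors-bound w uniq′ pals′) (≤-pred (≤-trans (≤-reflexive (sym len)) bound))

    RichWitness-++⁻ : ∀ p {w : Word A} → RichWitness (p ++ w) → RichWitness w
    RichWitness-++⁻ []      rw = rw
    RichWitness-++⁻ (x ∷ p) rw = RichWitness-++⁻ p (RichWitness-∷⁻ rw)

    RichWitness⇒Rich : ∀ w → RichWitness w → Rich w
    RichWitness⇒Rich w (L , uniq , pals , len) = L , uniq , pals , complete , len
      where
      open import Data.List.Membership.DecPropositional (≡-dec _≟_) using (_∈?_)
      complete : ∀ u → PalFactor w u → u ∈ L
      complete u pf with u ∈? L
      ... | yes u∈L = u∈L
      ... | no  u∉L = contradiction (palFactors-bound w (¬Any⇒All¬ L u∉L ∷ uniq) (pf ∷ pals)) λ bound →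
                        <-irrefl refl (≤-trans bound (≤-reflexive (sym len)))

-- Block reversals

data BR {A : Set} : Word A → Word A → Set where
  single : ∀ w → BR w w
  _◃_    : ∀ {B w v} → NonEmpty B → BR w v → BR (B ++ w) (v ++ B)

module _ {A : Set} where
  open ≡-Reasoning

  InBR⇒BR : ∀ {w v : Word A} → InBR w v → BR w v
  InBR⇒BR (Bs , t≥1 , nonEmpty , refl , refl) = blocks Bs t≥1 nonEmpty
    where
    blocks : ∀ Bs → length Bs ≥ 1 → All NonEmpty Bs → BR (concat Bs) (concat (reverse Bs))
    blocks (B ∷ [])      _ _            = single (B ++ [])
    blocks (B ∷ B′ ∷ Bs) _ (ne ∷ nes) = subst (BR _) (sym reversed) (ne ◃ blocks (B′ ∷ Bs) (s≤s z≤n) nes)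
      where
      reversed : concat (reverse (B ∷ B′ ∷ Bs)) ≡ concat (reverse (B′ ∷ Bs)) ++ B
      reversed = begin
        concat (reverse (B ∷ B′ ∷ Bs))               ≡⟨ cong concat (unfold-reverse B (B′ ∷ Bs)) ⟩
        concat (reverse (B′ ∷ Bs) ++ [ B ])          ≡⟨ sym (concat-++ (reverse (B′ ∷ Bs)) [ B ]) ⟩
        concat (reverse (B′ ∷ Bs)) ++ B ++ []        ≡⟨ cong (concat (reverse (B′ ∷ Bs)) ++_) (++-identityʳ B) ⟩
        concat (reverse (B′ ∷ Bs)) ++ B              ∎

  BR-[] : ∀ {w v : Word A} → BR w v → w ≡ [] → v ≡ []
  BR-[] (single _)            eq = eq
  BR-[] ((_ , _ , refl) ◃ _) ()

-- Binary words: false plays the letter a and true the letter b.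
infix 8 a^_ b^_
a^_ b^_ : ℕ → Word Bool
a^ n = replicate n false
b^ n = replicate n true

#b : Word Bool → ℕ
#b []          = 0
#b (false ∷ w) = #b w
#b (true  ∷ w) = suc (#b w)

#b-++ : ∀ x y → #b (x ++ y) ≡ #b x + #b y
#b-++ []          y = refl
#b-++ (false ∷ x) y = #b-++ x y
#b-++ (true  ∷ x) y = cong suc (#b-++ x y)

#b-factor : ∀ {u w} → Factor u w → #b u ≤ #b w
#b-factor {u} (p , s , refl) = begin
  #b u                ≤⟨ m≤m+n (#b u) (#b s) ⟩
  #b u + #b s         ≡⟨ sym (#b-++ u s) ⟩
  #b (u ++ s)         ≤⟨ m≤n+m _ (#b p) ⟩
  #b p + #b (u ++ s)  ≡⟨ sym (#b-++ p _) ⟩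
  #b (p ++ u ++ s)    ∎
  where open ≤-Reasoning

#b-pump : ∀ x n z → #b (x ++ a^ n ++ z) ≡ #b (x ++ z)
#b-pump []          zero    z = refl
#b-pump []          (suc n) z = #b-pump [] n z
#b-pump (false ∷ x) n       z = #b-pump x n z
#b-pump (true  ∷ x) n       z = cong suc (#b-pump x n z)

#b-a^ : ∀ n → #b (a^ n) ≡ 0
#b-a^ zero    = refl
#b-a^ (suc n) = #b-a^ n

#b-b^ : ∀ n → #b (b^ n) ≡ n
#b-b^ zero    = refl
#b-b^ (suc n) = cong suc (#b-b^ n)

#b-a^b^a^ : ∀ m k n → #b (a^ m ++ b^ k ++ a^ n) ≡ k
#b-a^b^a^ m k n = begin
  #b (a^ m ++ b^ k ++ a^ n)  ≡⟨ #b-pump [] m _ ⟩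
  #b (b^ k ++ a^ n)          ≡⟨ #b-++ (b^ k) (a^ n) ⟩
  #b (b^ k) + #b (a^ n)      ≡⟨ cong₂ _+_ (#b-b^ k) (#b-a^ n) ⟩
  k + 0                      ≡⟨ +-identityʳ k ⟩
  k                          ∎
  where open ≡-Reasoning

#b≡0 : ∀ s → #b s ≡ 0 → s ≡ a^ length s
#b≡0 []          _  = refl
#b≡0 (false ∷ s) eq = cong (false ∷_) (#b≡0 s eq)

opensRun : Bool → Bool → ℕ
opensRun _     false = 0
opensRun false true  = 1
opensRun true  true  = 0

bRunsAfter : Bool → Word Bool → ℕ
bRunsAfter _ []      = 0
bRunsAfter c (y ∷ w) = opensRun c y + bRunsAfter y w

bRuns : Word Bool → ℕ
bRuns = bRunsAfter false

bRunsAfter-prefix : ∀ c u s → bRunsAfter c u ≤ bRunsAfter c (u ++ s)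
bRunsAfter-prefix c []      s = z≤n
bRunsAfter-prefix c (y ∷ u) s = +-monoʳ-≤ (opensRun c y) (bRunsAfter-prefix y u s)

bRuns-∷ : ∀ y w → bRuns w ≤ bRuns (y ∷ w)
bRuns-∷ false w           = ≤-refl
bRuns-∷ true  []          = z≤n
bRuns-∷ true  (false ∷ w) = n≤1+n _
bRuns-∷ true  (true ∷ w)  = ≤-refl

bRuns-factor : ∀ {u w} → Factor u w → bRuns u ≤ bRuns w
bRuns-factor {u} (p , s , refl) = ≤-trans (bRunsAfter-prefix false u s) (in-context p)
  where
  in-context : ∀ p {w} → bRuns w ≤ bRuns (p ++ w)
  in-context []          = ≤-refl
  in-context (y ∷ p) {w} = ≤-trans (in-context p {w}) (bRuns-∷ y (p ++ w))

bRuns-pump : ∀ c x n z → bRunsAfter c (x ++ a^ n ++ false ∷ z) ≡ bRunsAfter c (x ++ false ∷ z)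
bRuns-pump c []      zero    z = refl
bRuns-pump c []      (suc n) z = bRuns-pump false [] n z
bRuns-pump c (y ∷ x) n       z = cong (opensRun c y +_) (bRuns-pump y x n z)

trailingAsAfter : ℕ → Word Bool → ℕ
trailingAsAfter n []          = n
trailingAsAfter n (false ∷ w) = trailingAsAfter (suc n) w
trailingAsAfter n (true  ∷ w) = trailingAsAfter 0 w

trailingAs : Word Bool → ℕ
trailingAs = trailingAsAfter 0

trailingAsAfter-++ : ∀ n x y → trailingAsAfter n (x ++ y) ≡ trailingAsAfter (trailingAsAfter n x) y
trailingAsAfter-++ n []          y = refl
trailingAsAfter-++ n (false ∷ x) y = trailingAsAfter-++ (suc n) x y
trailingAsAfter-++ n (true  ∷ x) y = trailingAsAfter-++ 0 x y

trailingAsAfter-b : ∀ m n y → 0 < #b y → trailingAsAfter m y ≡ trailingAsAfter n y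
trailingAsAfter-b m n (false ∷ y) pos = trailingAsAfter-b (suc m) (suc n) y pos
trailingAsAfter-b m n (true  ∷ y) _   = refl

trailingAsAfter-a^ : ∀ n ℓ → trailingAsAfter n (a^ ℓ) ≡ ℓ + n
trailingAsAfter-a^ n zero    = refl
trailingAsAfter-a^ n (suc ℓ) = trans (trailingAsAfter-a^ (suc n) ℓ) (+-suc ℓ n)

trailingAs-suffix : ∀ {y w} → Suffix y w → 0 < #b y → trailingAs w ≡ trailingAs y
trailingAs-suffix {y} (h , refl) pos = trans (trailingAsAfter-++ 0 h y) (trailingAsAfter-b _ 0 y pos)

trailingAs-a^b^a^ : ∀ m k n → trailingAs (a^ m ++ b^ suc k ++ a^ n) ≡ n
trailingAs-a^b^a^ m k n = begin
  trailingAs (a^ m ++ b^ suc k ++ a^ n)            ≡⟨ trailingAs-suffix (Suffix-++ˡ (a^ m) ([] , refl)) (s≤s z≤n) ⟩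
  trailingAsAfter 0 (b^ k ++ a^ n)                 ≡⟨ trailingAsAfter-++ 0 (b^ k) (a^ n) ⟩
  trailingAsAfter (trailingAsAfter 0 (b^ k)) (a^ n) ≡⟨ trailingAsAfter-a^ _ n ⟩
  n + trailingAsAfter 0 (b^ k)                     ≡⟨ cong (n +_) (no-trailing k) ⟩
  n + 0                                            ≡⟨ +-identityʳ n ⟩
  n                                                ∎
  where
  open ≡-Reasoning
  no-trailing : ∀ k → trailingAsAfter 0 (b^ k) ≡ 0
  no-trailing zero    = refl
  no-trailing (suc k) = no-trailing k

-- Once u and w contain the same b's, an occurrence of u in w can only be followed by a's.
trailingAs-factor : ∀ {u w} → Factor u w → #b u ≡ #b w → 0 < #b u → trailingAs u ≤ trailingAs w
trailingAs-factor {u} (p , s , refl) same pos = begin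
  trailingAs u                                     ≤⟨ m≤n+m _ (length s) ⟩
  length s + trailingAs u                          ≡⟨ cong (length s +_) (trailingAsAfter-b 0 _ u pos) ⟩
  length s + trailingAsAfter (trailingAs p) u      ≡⟨ sym (trailingAsAfter-a^ _ (length s)) ⟩
  trailingAsAfter (trailingAsAfter (trailingAs p) u) (a^ length s)
                                                   ≡⟨ sym (trans (trailingAsAfter-++ 0 p _) (trailingAsAfter-++ _ u _)) ⟩
  trailingAs (p ++ u ++ a^ length s)               ≡⟨ cong (λ s′ → trailingAs (p ++ u ++ s′)) (sym (#b≡0 s no-b)) ⟩
  trailingAs (p ++ u ++ s)                         ∎
  where
  open ≤-Reasoning
  no-b : #b s ≡ 0
  no-b = n≤0⇒n≡0 (+-cancelˡ-≤ (#b u) (#b s) 0 (begin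
    #b u + #b s         ≡⟨ sym (#b-++ u s) ⟩
    #b (u ++ s)         ≤⟨ m≤n+m _ (#b p) ⟩
    #b p + #b (u ++ s)  ≡⟨ sym (#b-++ p _) ⟩
    #b (p ++ u ++ s)    ≡⟨ sym same ⟩
    #b u                ≡⟨ sym (+-identityʳ _) ⟩
    #b u + 0            ∎))

RichWitness-a^ : ∀ X → RichWitness (a^ X)
RichWitness-a^ zero    = [] , [] , [] , refl
RichWitness-a^ (suc X) = subst RichWitness (replicate-∷ʳ false X)
  (RichWitness-∷ʳ false (RichWitness-a^ X)
    ((false , a^ X , refl) , reverse-replicate false (suc X) , ([] , sym (replicate-∷ʳ false X))) new)
  where
  new : ¬ Factor (a^ suc X) (a^ X)
  new fac = 1+n≰n (subst₂ _≤_ (length-replicate (suc X)) (length-replicate X) (Factor-length fac))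

RichWitness-a^b^ : ∀ X c → RichWitness (a^ X ++ b^ c)
RichWitness-a^b^ X zero    = subst RichWitness (sym (++-identityʳ _)) (RichWitness-a^ X)
RichWitness-a^b^ X (suc c) = subst RichWitness extended
  (RichWitness-∷ʳ true (RichWitness-a^b^ X c)
    ((true , b^ c , refl) , reverse-replicate true (suc c) , (a^ X , sym extended)) new)
  where
  extended : (a^ X ++ b^ c) ∷ʳ true ≡ a^ X ++ b^ suc c
  extended = trans (++-assoc (a^ X) (b^ c) [ true ]) (cong (a^ X ++_) (replicate-∷ʳ true c))
  new : ¬ Factor (b^ suc c) (a^ X ++ b^ c)
  new fac = 1+n≰n (subst₂ _≤_ (#b-b^ (suc c)) (trans (#b-pump [] X (b^ c)) (#b-b^ c)) (#b-factor fac))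

RichWitness-a^b^a^ : ∀ X k i → i ≤ X → RichWitness (a^ X ++ b^ suc k ++ a^ i)
RichWitness-a^b^a^ X k zero    _   = subst RichWitness (cong (a^ X ++_) (sym (++-identityʳ _))) (RichWitness-a^b^ X (suc k))
RichWitness-a^b^a^ X k (suc i) i<X = subst RichWitness extended
  (RichWitness-∷ʳ false (RichWitness-a^b^a^ X k i (<⇒≤ i<X)) ((false , _ , refl) , palindrome , suffix) new)
  where
  u = a^ suc i ++ b^ suc k ++ a^ suc i
  extended : (a^ X ++ b^ suc k ++ a^ i) ∷ʳ false ≡ a^ X ++ b^ suc k ++ a^ suc i
  extended = trans (++-assoc₃ (a^ X) (b^ suc k) (a^ i) [ false ]) (cong (λ w → a^ X ++ b^ suc k ++ w) (replicate-∷ʳ false i))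
  palindrome : Palindrome u
  palindrome = subst (λ w → Palindrome (w ++ b^ suc k ++ a^ suc i)) (reverse-replicate false (suc i))
                 (palindrome-wrap (a^ suc i) (b^ suc k) (reverse-replicate true (suc k)))
  suffix : Suffix u ((a^ X ++ b^ suc k ++ a^ i) ∷ʳ false)
  suffix = a^ (X ∸ suc i) , trans (replicate-+ false (X ∸ suc i) (suc i) _)
             (trans (cong (λ n → a^ n ++ b^ suc k ++ a^ suc i) (m∸n+n≡m i<X)) (sym extended))
  new : ¬ Factor u (a^ X ++ b^ suc k ++ a^ i)
  new fac = 1+n≰n (subst₂ _≤_ (trailingAs-a^b^a^ (suc i) k (suc i)) (trailingAs-a^b^a^ X k i)
              (trailingAs-factor fac (trans (#b-a^b^a^ (suc i) (suc k) (suc i)) (sym (#b-a^b^a^ X (suc k) i)))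
                (subst (0 <_) (sym (#b-a^b^a^ (suc i) (suc k) (suc i))) (s≤s z≤n))))

-- Checking the words a^X b^k a^Y T for all X and Y at once

lps : Word Bool → Word Bool
lps = longestPalSuffix _≟ᵇ_

checkEach : (Word Bool → Bool → Bool) → Word Bool → Word Bool → Bool
checkEach ok C []       = true
checkEach ok C (x ∷ ws) = ok C x ∧ checkEach ok (C ∷ʳ x) ws

checkEach-sound : ∀ (F : Word Bool → Set) ok → (∀ C x → T (ok C x) → F C → F (C ∷ʳ x)) →
  ∀ C ws → T (checkEach ok C ws) → F C → F (C ++ ws)
checkEach-sound F ok step C []       _    fC = subst F (sym (++-identityʳ C)) fC
checkEach-sound F ok step C (x ∷ ws) okws fC with to T-∧ okws
... | ok-x , ok-ws = subst F (∷ʳ-++ C x ws) (checkEach-sound F ok step (C ∷ʳ x) ws ok-ws (step C x ok-x fC))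

allUpTo : (ℕ → Bool) → ℕ → Bool
allUpTo f zero    = f zero
allUpTo f (suc n) = allUpTo f n ∧ f (suc n)

allUpTo-sound : ∀ f n {m} → T (allUpTo f n) → m ≤ n → T (f m)
allUpTo-sound f zero    t z≤n   = t
allUpTo-sound f (suc n) t m≤1+n with m≤n⇒m<n∨m≡n m≤1+n | to T-∧ t
... | inj₁ m<1+n | t-n , _    = allUpTo-sound f n t-n (≤-pred m<1+n)
... | inj₂ refl  | _ , t-last = t-last

-- Behind a run of at least |u| a's, whether u occurs does not depend on the length of the run,
-- so only runs of length at most |u| need to be checked.
runStep : Word Bool → Bool → Bool
runStep C x = allUpTo (λ d → not (isYes (factor? _≟ᵇ_ (lps (C ∷ʳ x)) (a^ d ++ C)))) (length (lps (C ∷ʳ x)))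

runStep-sound : ∀ d C x → T (runStep C x) → RichWitness (a^ d ++ C) → RichWitness (a^ d ++ (C ∷ʳ x))
runStep-sound d C x ok rw = subst RichWitness (++-assoc (a^ d) C [ x ]) (RichWitness-∷ʳ x rw pal-suffix new)
  where
  u = lps (C ∷ʳ x)
  pal-suffix : PalSuffix u ((a^ d ++ C) ∷ʳ x)
  pal-suffix = subst (PalSuffix u) (sym (++-assoc (a^ d) C [ x ])) (PalSuffix-++ˡ (a^ d) (longestPalSuffix-∷ʳ _≟ᵇ_ C x))
  absent : ∀ {e} → e ≤ length u → ¬ Factor u (a^ e ++ C)
  absent {e} e≤ = toWitnessFalse {a? = factor? _≟ᵇ_ u (a^ e ++ C)} (allUpTo-sound _ (length u) ok e≤)
  new : ¬ Factor u (a^ d ++ C)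
  new fac with d ≤? length u
  ... | yes d≤ = absent d≤ fac
  ... | no  d≰ = absent ≤-refl (Factor-shorten-run false [] (d ∸ length u) (length u) C ≤-refl
                   (subst (λ n → Factor u (a^ n ++ C)) (sym (m∸n+n≡m (<⇒≤ (≰⇒> d≰)))) fac))

twoRuns : ℕ → ℕ → ℕ → Word Bool → Word Bool
twoRuns d y k Tl = a^ d ++ a^ 5 ++ b^ k ++ a^ y ++ a^ 5 ++ Tl

twoRuns-∷ʳ : ∀ d y k Tl x → twoRuns d y k Tl ∷ʳ x ≡ twoRuns d y k (Tl ∷ʳ x)
twoRuns-∷ʳ d y k Tl x =
  trans (++-assoc (a^ d) _ [ x ]) (cong (λ w → a^ d ++ a^ 5 ++ w) (++-assoc₃ (b^ k) (a^ y) (a^ 5 ++ Tl) [ x ]))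

twoRuns-#b : ∀ d y k Tl → #b (twoRuns d y k Tl) ≡ #b (twoRuns 0 0 k Tl)
twoRuns-#b d y k Tl = trans (#b-pump [] d _) (#b-pump (a^ 5 ++ b^ k) y (a^ 5 ++ Tl))

twoRuns-bRuns : ∀ d y k Tl → bRuns (twoRuns d y k Tl) ≡ bRuns (twoRuns 0 0 k Tl)
twoRuns-bRuns d y k Tl = trans (bRuns-pump false [] d _) (bRuns-pump false (a^ 5 ++ b^ k) y (a^ 4 ++ Tl))

twoRuns-trailingAs : ∀ d y k Tl → 0 < #b Tl → trailingAs (twoRuns d y k Tl) ≡ trailingAs Tl
twoRuns-trailingAs d y k Tl =
  trailingAs-suffix (Suffix-++ˡ (a^ d) (Suffix-++ˡ (a^ 5) (Suffix-++ˡ (b^ k) (Suffix-++ˡ (a^ y) (Suffix-++ˡ (a^ 5) ([] , refl))))))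

-- A step adding a palindromic suffix of length at most 5: such a word occurs in
-- twoRuns d y k Tl iff it occurs in twoRuns 0 0 k Tl.
shortPal : Word Bool → Bool → Word Bool
shortPal Tl x = lps (a^ 5 ++ (Tl ∷ʳ x))

shortStep : ℕ → Word Bool → Bool → Bool
shortStep k Tl x = (length (shortPal Tl x) ≤ᵇ 5) ∧ not (isYes (factor? _≟ᵇ_ (shortPal Tl x) (twoRuns 0 0 k Tl)))

shortStep-sound : ∀ d y k Tl x → T (shortStep k Tl x) → RichWitness (twoRuns d y k Tl) → RichWitness (twoRuns d y k (Tl ∷ʳ x))
shortStep-sound d y k Tl x ok rw with to T-∧ ok
... | short , absent = subst RichWitness (twoRuns-∷ʳ d y k Tl x) (RichWitness-∷ʳ x rw pal-suffix new)
  where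
  u = shortPal Tl x
  |u|≤5 : length u ≤ 5
  |u|≤5 = ≤ᵇ⇒≤ (length u) 5 short
  pal-suffix : PalSuffix u (twoRuns d y k Tl ∷ʳ x)
  pal-suffix = subst (PalSuffix u) (sym (twoRuns-∷ʳ d y k Tl x))
                 (PalSuffix-++ˡ (a^ d) (PalSuffix-++ˡ (a^ 5 ++ b^ k) (PalSuffix-++ˡ (a^ y) (longestPalSuffix-∷ʳ _≟ᵇ_ (a^ 5 ++ Tl) x))))
  new : ¬ Factor u (twoRuns d y k Tl)
  new fac = toWitnessFalse {a? = factor? _≟ᵇ_ u (twoRuns 0 0 k Tl)} absent
    (Factor-shorten-run false (a^ 5 ++ b^ k) y 5 Tl |u|≤5
      (subst (λ w → Factor u (a^ 5 ++ b^ k ++ w)) (replicate-+ false y 5 Tl)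
        (Factor-shorten-run false [] d 5 _ |u|≤5 (subst (Factor u) (replicate-+ false d 5 _) fac))))

widePal : ℕ → Word Bool → Bool → Word Bool
widePal y Tl x = reverse (Tl ∷ʳ x) ++ a^ y ++ a^ 5 ++ (Tl ∷ʳ x)

widePal-#b : ∀ y Tl x → #b (widePal y Tl x) ≡ #b (widePal 0 Tl x)
widePal-#b y Tl x = #b-pump (reverse (Tl ∷ʳ x)) y (a^ 5 ++ (Tl ∷ʳ x))

widePal-bRuns : ∀ y Tl x → bRuns (widePal y Tl x) ≡ bRuns (widePal 0 Tl x)
widePal-bRuns y Tl x = bRuns-pump false (reverse (Tl ∷ʳ x)) y (a^ 4 ++ (Tl ∷ʳ x))

widePal-suffix : ∀ y Tl x → Suffix (Tl ∷ʳ x) (widePal y Tl x)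
widePal-suffix y Tl x = Suffix-++ˡ (reverse (Tl ∷ʳ x)) (Suffix-++ˡ (a^ y) (Suffix-++ˡ (a^ 5) ([] , refl)))

-- widePal y Tl x cannot occur in twoRuns d y k Tl if, measured on the versions with d = y = 0,
-- it has more b's, or more runs of b's, or as many b's but a longer final run of a's.
separated : ℕ → Word Bool → Bool → Bool
separated k Tl x =
  (#b (twoRuns 0 0 k Tl) <ᵇ #b (widePal 0 Tl x)) ∨
  (bRuns (twoRuns 0 0 k Tl) <ᵇ bRuns (widePal 0 Tl x)) ∨
  ((#b (widePal 0 Tl x) ≡ᵇ #b (twoRuns 0 0 k Tl)) ∧ (0 <ᵇ #b Tl) ∧ (trailingAs Tl <ᵇ trailingAs (Tl ∷ʳ x)))

separated-sound : ∀ d y k Tl x → T (separated k Tl x) → ¬ Factor (widePal y Tl x) (twoRuns d y k Tl)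
separated-sound d y k Tl x ok fac with to T-∨ ok
... | inj₁ more-b =
  <⇒≱ (subst₂ _<_ (sym (twoRuns-#b d y k Tl)) (sym (widePal-#b y Tl x)) (<ᵇ⇒< _ _ more-b)) (#b-factor fac)
... | inj₂ ok′ with to T-∨ ok′
...   | inj₁ more-runs =
  <⇒≱ (subst₂ _<_ (sym (twoRuns-bRuns d y k Tl)) (sym (widePal-bRuns y Tl x)) (<ᵇ⇒< _ _ more-runs)) (bRuns-factor fac)
...   | inj₂ ok″ with to T-∧ ok″
...     | same-b , ok‴ with to T-∧ ok‴
...       | Tl-has-b , longer-tail = <⇒≱ longer (trailingAs-factor fac same u-has-b)
  where
  u2-has-b : 0 < #b (Tl ∷ʳ x)
  u2-has-b = ≤-trans (<ᵇ⇒< 0 (#b Tl) Tl-has-b) (#b-factor {Tl} ([] , [ x ] , refl))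
  u-has-b : 0 < #b (widePal y Tl x)
  u-has-b = ≤-trans u2-has-b (#b-factor (Suffix⇒Factor (widePal-suffix y Tl x)))
  same : #b (widePal y Tl x) ≡ #b (twoRuns d y k Tl)
  same = trans (widePal-#b y Tl x) (trans (≡ᵇ⇒≡ _ _ same-b) (sym (twoRuns-#b d y k Tl)))
  longer : trailingAs (twoRuns d y k Tl) < trailingAs (widePal y Tl x)
  longer = subst₂ _<_ (sym (twoRuns-trailingAs d y k Tl (<ᵇ⇒< 0 _ Tl-has-b)))
             (sym (trailingAs-suffix (widePal-suffix y Tl x) u2-has-b)) (<ᵇ⇒< _ _ longer-tail)

wideStep : ℕ → Word Bool → Bool → Bool
wideStep k Tl x = isYes (suffix? _≟ᵇ_ (reverse (Tl ∷ʳ x)) (a^ 5 ++ b^ k)) ∧ separated k Tl x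

wideStep-sound : ∀ d y k Tl x → T (wideStep k Tl x) → RichWitness (twoRuns d y k Tl) → RichWitness (twoRuns d y k (Tl ∷ʳ x))
wideStep-sound d y k Tl x ok rw with to T-∧ ok
... | fits , sep = subst RichWitness (twoRuns-∷ʳ d y k Tl x)
                     (RichWitness-∷ʳ x rw (non-empty , palindrome , subst (Suffix u) (sym (twoRuns-∷ʳ d y k Tl x)) suffix)
                       (separated-sound d y k Tl x sep))
  where
  u2 = Tl ∷ʳ x
  u  = widePal y Tl x
  R  = a^ y ++ a^ 5 ++ u2
  non-empty : NonEmpty u
  non-empty = x , reverse Tl ++ R , cong (_++ R) (reverse-++ Tl [ x ])
  palindrome : Palindrome u
  palindrome = subst Palindrome (sym (cong (reverse u2 ++_) (replicate-+ false y 5 u2)))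
                 (palindrome-wrap u2 (a^ (y + 5)) (reverse-replicate false (y + 5)))
  suffix : Suffix u (twoRuns d y k u2)
  suffix with toWitness {a? = suffix? _≟ᵇ_ (reverse u2) (a^ 5 ++ b^ k)} fits
  ... | h , h++rev = Suffix-++ˡ (a^ d) (h , trans (sym (++-assoc h (reverse u2) R)) (cong (_++ R) h++rev))

twoRunStep : ℕ → Word Bool → Bool → Bool
twoRunStep k Tl x = shortStep k Tl x ∨ wideStep k Tl x

twoRunStep-sound : ∀ d y k Tl x → T (twoRunStep k Tl x) → RichWitness (twoRuns d y k Tl) → RichWitness (twoRuns d y k (Tl ∷ʳ x))
twoRunStep-sound d y k Tl x ok with to T-∨ ok
... | inj₁ short = shortStep-sound d y k Tl x short
... | inj₂ wide  = wideStep-sound d y k Tl x wide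

RichFamily : ℕ → Word Bool → Set
RichFamily k Tl = ∀ X Y → RichWitness (a^ X ++ b^ k ++ a^ Y ++ Tl)

familyCheck : ℕ → Word Bool → Bool
familyCheck k Tl = allUpTo (λ Y → checkEach runStep (a^ suc Y ++ b^ k ++ a^ Y) Tl) 4 ∧ checkEach (twoRunStep k) [] Tl

family-one-run : ∀ k Tl X Y → T (checkEach runStep (a^ suc Y ++ b^ suc k ++ a^ Y) Tl) →
  RichWitness (a^ X ++ a^ suc Y ++ b^ suc k ++ a^ Y ++ Tl)
family-one-run k Tl X Y ok = subst (λ w → RichWitness (a^ X ++ w)) (++-assoc₃ (a^ suc Y) (b^ suc k) (a^ Y) Tl)
  (checkEach-sound (λ C → RichWitness (a^ X ++ C)) runStep (runStep-sound X) _ Tl ok start)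
  where
  start : RichWitness (a^ X ++ a^ suc Y ++ b^ suc k ++ a^ Y)
  start = subst RichWitness (sym (replicate-+ false X (suc Y) _))
            (RichWitness-a^b^a^ (X + suc Y) k Y (≤-trans (n≤1+n Y) (m≤n+m (suc Y) X)))

family-two-runs : ∀ k Tl X y → T (checkEach (twoRunStep (suc k)) [] Tl) →
  RichWitness (a^ X ++ a^ suc (y + 5) ++ b^ suc k ++ a^ (y + 5) ++ Tl)
family-two-runs k Tl X y ok = subst RichWitness reshape
  (checkEach-sound (λ Tl → RichWitness (twoRuns d y (suc k) Tl)) (twoRunStep (suc k)) (twoRunStep-sound d y (suc k)) [] Tl ok start)
  where
  d = X + suc y
  merge : ∀ z → twoRuns d y (suc k) z ≡ a^ (d + 5) ++ b^ suc k ++ a^ (y + 5) ++ z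
  merge z = trans (replicate-+ false d 5 _) (cong (λ w → a^ (d + 5) ++ b^ suc k ++ w) (replicate-+ false y 5 z))
  start : RichWitness (twoRuns d y (suc k) [])
  start = subst RichWitness (sym (trans (merge []) (cong (λ w → a^ (d + 5) ++ b^ suc k ++ w) (++-identityʳ _))))
            (RichWitness-a^b^a^ (d + 5) k (y + 5) (+-monoˡ-≤ 5 (≤-trans (n≤1+n y) (m≤n+m (suc y) X))))
  reshape : twoRuns d y (suc k) Tl ≡ a^ X ++ a^ suc (y + 5) ++ b^ suc k ++ a^ (y + 5) ++ Tl
  reshape = begin
    twoRuns d y (suc k) Tl                                   ≡⟨ merge Tl ⟩
    a^ (d + 5) ++ b^ suc k ++ a^ (y + 5) ++ Tl               ≡⟨ cong (λ n → a^ n ++ b^ suc k ++ a^ (y + 5) ++ Tl) (+-assoc X (suc y) 5) ⟩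
    a^ (X + suc (y + 5)) ++ b^ suc k ++ a^ (y + 5) ++ Tl     ≡⟨ sym (replicate-+ false X (suc (y + 5)) _) ⟩
    a^ X ++ a^ suc (y + 5) ++ b^ suc k ++ a^ (y + 5) ++ Tl   ∎
    where open ≡-Reasoning

-- Words whose first run of a's is longer than the second are checked letter by letter along Tl;
-- the remaining ones are suffixes of those.
family-sound : ∀ k Tl → T (familyCheck (suc k) Tl) → RichFamily (suc k) Tl
family-sound k Tl ok X Y with to T-∧ ok
... | one-run , two-runs =
  RichWitness-++⁻ _≟ᵇ_ (a^ suc Y) (subst RichWitness (replicate-swap false X (suc Y) _) longer-first-run)
  where
  longer-first-run : RichWitness (a^ X ++ a^ suc Y ++ b^ suc k ++ a^ Y ++ Tl)
  longer-first-run with Y ≤? 4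
  ... | yes Y≤4 = family-one-run k Tl X Y (allUpTo-sound (λ Y → checkEach runStep (a^ suc Y ++ b^ suc k ++ a^ Y) Tl) 4 one-run Y≤4)
  ... | no  Y≰4 = subst (λ Y → RichWitness (a^ X ++ a^ suc Y ++ b^ suc k ++ a^ Y ++ Tl)) (m∸n+n≡m (≰⇒> Y≰4))
                    (family-two-runs k Tl X (Y ∸ 5) two-runs)

-- The elements of BR(a^i b^M a) are lead s t ++ a^j ++ b^(k+1) ++ a^e with s + t + k + 1 = M,
-- where lead s t is b^s a b^t, except that for t = 0 its a is counted in the next run.
lead : ℕ → ℕ → Word Bool
lead s zero    = b^ s
lead s (suc t) = b^ s ++ false ∷ b^ suc t

Shape : ℕ → Word Bool → Set
Shape M v = Σ ℕ λ s → Σ ℕ λ t → Σ ℕ λ k → s + t + suc k ≡ M × Σ ℕ λ j → Σ ℕ λ e → v ≡ lead s t ++ a^ j ++ b^ suc k ++ a^ e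

shape-from-blocks : ∀ {M} s t i k e → s + t + suc k ≡ M → Shape M (b^ s ++ false ∷ b^ t ++ a^ i ++ b^ suc k ++ a^ e)
shape-from-blocks s zero    i k e sum = s , 0 , k , sum , suc i , e , refl
shape-from-blocks s (suc t) i k e sum = s , suc t , k , sum , i , e , sym (++-assoc (b^ s) (false ∷ b^ suc t) _)

Shape-++a^ : ∀ n {M v} → Shape M v → Shape M (v ++ a^ n)
Shape-++a^ n (s , t , k , sum , j , e , refl) = s , t , k , sum , j , e + n , (begin
  (lead s t ++ a^ j ++ b^ suc k ++ a^ e) ++ a^ n  ≡⟨ ++-assoc (lead s t) _ _ ⟩
  lead s t ++ (a^ j ++ b^ suc k ++ a^ e) ++ a^ n  ≡⟨ cong (lead s t ++_) (++-assoc₃ (a^ j) (b^ suc k) (a^ e) (a^ n)) ⟩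
  lead s t ++ a^ j ++ b^ suc k ++ a^ e ++ a^ n    ≡⟨ cong (λ w → lead s t ++ a^ j ++ b^ suc k ++ w) (replicate-++ false e n) ⟩
  lead s t ++ a^ j ++ b^ suc k ++ a^ (e + n)      ∎)
  where open ≡-Reasoning

BR-b^a : ∀ {w v} → BR w v → ∀ j → w ≡ b^ j ++ [ false ] → Σ ℕ λ s → Σ ℕ λ t → s + t ≡ j × v ≡ b^ s ++ false ∷ b^ t
BR-b^a (single _) j refl = j , 0 , +-identityʳ j , refl
BR-b^a (_◃_ {B} {w′} _ br) j eq with ++-replicate-split true j B w′ [ false ] eq
... | inj₁ (i , r , i+r , refl , rest) with BR-b^a br r rest
...   | s , t , refl , refl =
  s , t + i , trans (sym (+-assoc s t i)) (trans (+-comm (s + t) i) i+r) ,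
  trans (++-assoc (b^ s) (false ∷ b^ t) (b^ i)) (cong (λ w → b^ s ++ false ∷ w) (replicate-++ true t i))
BR-b^a (_ ◃ br) j eq | inj₂ ([] , refl , refl) with BR-b^a br 0 refl
... | zero  , zero  , _  , refl = 0 , j , refl , cong (false ∷_) (++-identityʳ (b^ j))
... | zero  , suc _ , () , _
... | suc _ , _     , () , _
BR-b^a (_ ◃ br) j eq | inj₂ (false ∷ x , refl , rest)
  with ++-conicalˡ x _ (∷-injectiveʳ rest) | BR-[] br (++-conicalʳ x _ (∷-injectiveʳ rest))
... | refl | refl = j , 0 , +-identityʳ j , refl
BR-b^a (_ ◃ br) j eq | inj₂ (true ∷ x , refl , ())

BR-shape : ∀ M {w v} → BR w v → ∀ i → w ≡ a^ i ++ b^ suc M ++ [ false ] → Shape (suc M) v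
BR-shape M (single _) i refl = 0 , 0 , M , refl , i , 1 , refl
BR-shape M (_◃_ {B} {w′} _ br) i eq with ++-replicate-split false i B w′ _ eq
... | inj₁ (i₁ , r , _ , refl , rest) = Shape-++a^ i₁ (BR-shape M br r rest)
... | inj₂ (x , refl , rest) with ++-replicate-split true (suc M) x w′ [ false ] rest
...   | inj₁ (zero , _ , refl , refl , rest′) =
  subst (Shape (suc M)) (cong (_ ++_) (sym (++-identityʳ (a^ i)))) (Shape-++a^ i (BR-shape M br 0 rest′))
...   | inj₁ (suc m , r , m+r , refl , rest′) with BR-b^a br r rest′
...     | s , t , refl , refl =
  subst (Shape (suc M)) blocks (shape-from-blocks s t i m 0 (trans (+-comm (s + t) (suc m)) m+r))
  where
  blocks : b^ s ++ false ∷ b^ t ++ a^ i ++ b^ suc m ++ [] ≡ (b^ s ++ false ∷ b^ t) ++ a^ i ++ b^ suc m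
  blocks = trans (cong (λ w → b^ s ++ false ∷ b^ t ++ a^ i ++ w) (++-identityʳ (b^ suc m))) (sym (++-assoc (b^ s) _ _))
BR-shape M (_ ◃ br) i eq | inj₂ (x , refl , rest) | inj₂ ([] , refl , refl) with BR-b^a br 0 refl
... | zero  , zero  , _  , refl = shape-from-blocks 0 0 i M 0 refl
... | zero  , suc _ , () , _
... | suc _ , _     , () , _
BR-shape M (_ ◃ br) i eq | inj₂ (x , refl , rest) | inj₂ (false ∷ y , refl , rest′)
  with ++-conicalˡ y _ (∷-injectiveʳ rest′) | BR-[] br (++-conicalʳ y _ (∷-injectiveʳ rest′))
... | refl | refl = 0 , 0 , M , refl , i , 1 , refl
BR-shape M (_ ◃ br) i eq | inj₂ (x , refl , rest) | inj₂ (true ∷ y , refl , ())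

tailsCheck : ℕ → Bool
tailsCheck M = allUpTo (λ s → allUpTo (λ t → allUpTo (λ k →
  not (s + t + suc k ≡ᵇ M) ∨ familyCheck (suc k) (reverse (lead s t))) M) M) M

tailsCheck-sound : ∀ M → T (tailsCheck M) → ∀ s t k → s + t + suc k ≡ M → RichFamily (suc k) (reverse (lead s t))
tailsCheck-sound M ok s t k refl =
  family-sound k _ (relevant (≡⇒≡ᵇ (s + t + suc k) M refl)
    (allUpTo-sound _ M (allUpTo-sound _ M (allUpTo-sound _ M ok s≤M) t≤M) k≤M))
  where
  relevant : ∀ {b c} → T b → T (not b ∨ c) → T c
  relevant {true} _ c = c
  s≤M : s ≤ s + t + suc k
  s≤M = ≤-trans (m≤m+n s t) (m≤m+n (s + t) (suc k))
  t≤M : t ≤ s + t + suc k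
  t≤M = ≤-trans (m≤n+m t s) (m≤m+n (s + t) (suc k))
  k≤M : k ≤ s + t + suc k
  k≤M = ≤-trans (n≤1+n k) (m≤n+m (suc k) (s + t))

families : ∀ {M} → M ≡ 3 ⊎ M ≡ 4 → ∀ s t k → s + t + suc k ≡ M → RichFamily (suc k) (reverse (lead s t))
families (inj₁ refl) = tailsCheck-sound 3 tt
families (inj₂ refl) = tailsCheck-sound 4 tt

reverse-shape : ∀ P j k e → reverse (P ++ a^ j ++ b^ k ++ a^ e) ≡ a^ e ++ b^ k ++ a^ j ++ reverse P
reverse-shape P j k e = begin
  reverse (P ++ a^ j ++ b^ k ++ a^ e)                               ≡⟨ reverse-++ P _ ⟩
  reverse (a^ j ++ b^ k ++ a^ e) ++ reverse P                       ≡⟨ cong (_++ reverse P) (reverse-++₃ (a^ j) (b^ k) (a^ e)) ⟩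
  (reverse (a^ e) ++ reverse (b^ k) ++ reverse (a^ j)) ++ reverse P ≡⟨ cong (λ w → (w ++ reverse (b^ k) ++ reverse (a^ j)) ++ reverse P) (reverse-replicate false e) ⟩
  (a^ e ++ reverse (b^ k) ++ reverse (a^ j)) ++ reverse P           ≡⟨ cong (λ w → (a^ e ++ w ++ reverse (a^ j)) ++ reverse P) (reverse-replicate true k) ⟩
  (a^ e ++ b^ k ++ reverse (a^ j)) ++ reverse P                     ≡⟨ cong (λ w → (a^ e ++ b^ k ++ w) ++ reverse P) (reverse-replicate false j) ⟩
  (a^ e ++ b^ k ++ a^ j) ++ reverse P                               ≡⟨ ++-assoc₃ (a^ e) (b^ k) (a^ j) (reverse P) ⟩
  a^ e ++ b^ k ++ a^ j ++ reverse P                                 ∎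
  where open ≡-Reasoning

shape-rich : ∀ {M} → M ≡ 3 ⊎ M ≡ 4 → ∀ {v} → Shape M v → RichWitness v
shape-rich M∈ (s , t , k , sum , j , e , refl) =
  RichWitness-reverse _ (subst RichWitness (sym (reverse-shape (lead s t) j (suc k) e)) (families M∈ s t k sum e j))

binary-rich : ∀ {M} → M ≡ 3 ⊎ M ≡ 4 → ∀ n v → InBR (a^ n ++ b^ M ++ [ false ]) v → Rich v
binary-rich M∈@(inj₁ refl) n v br = RichWitness⇒Rich _≟ᵇ_ v (shape-rich M∈ (BR-shape 2 (InBR⇒BR br) n refl))
binary-rich M∈@(inj₂ refl) n v br = RichWitness⇒Rich _≟ᵇ_ v (shape-rich M∈ (BR-shape 3 (InBR⇒BR br) n refl))

module _ {A : Set} (a b : A) (a≢b : a ≢ b) where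
  open ≡-Reasoning

  letter : Bool → A
  letter false = a
  letter true  = b

  letter-injective : Injective _≡_ _≡_ letter
  letter-injective {false} {false} _  = refl
  letter-injective {false} {true}  eq = ⊥-elim (a≢b eq)
  letter-injective {true}  {false} eq = ⊥-elim (a≢b (sym eq))
  letter-injective {true}  {true}  _  = refl

  letter-encoding : ∀ n M → map letter (a^ n ++ b^ M ++ [ false ]) ≡ replicate n a ++ replicate M b ++ a ∷ []
  letter-encoding n M = begin
    map letter (a^ n ++ b^ M ++ [ false ])               ≡⟨ map-++ letter (a^ n) _ ⟩
    map letter (a^ n) ++ map letter (b^ M ++ [ false ])  ≡⟨ cong (map letter (a^ n) ++_) (map-++ letter (b^ M) _) ⟩
    map letter (a^ n) ++ map letter (b^ M) ++ a ∷ []     ≡⟨ cong (_++ _) (map-replicate letter n false) ⟩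
    replicate n a ++ map letter (b^ M) ++ a ∷ []         ≡⟨ cong (λ w → replicate n a ++ w ++ a ∷ []) (map-replicate letter M true) ⟩
    replicate n a ++ replicate M b ++ a ∷ []             ∎

  aⁿbᴹa-rich : ∀ {M} → M ≡ 3 ⊎ M ≡ 4 → ∀ n v → InBR (replicate n a ++ replicate M b ++ a ∷ []) v → Rich v
  aⁿbᴹa-rich {M} M∈ n v br
    with InBR-map⁻ letter (a^ n ++ b^ M ++ [ false ]) v (subst (λ w → InBR w v) (sym (letter-encoding n M)) br)
  ... | v′ , refl , br′ = Rich-map letter letter-injective v′ (binary-rich M∈ n v′ br′)

lemma4p19 : {A : Set} (a b : A) → a ≢ b → (n₁ n₂ : ℕ) → n₁ ≥ 1 → (n₂ ≡ 3 ⊎ n₂ ≡ 4) →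
    (w : Word A) → (w ≡ replicate n₁ a ++ replicate n₂ b ++ a ∷ [] ⊎ w ≡ a ∷ replicate n₂ b ++ replicate n₁ a) →
    ∀ v → InBR w v → Rich v
lemma4p19 a b a≢b n₁ n₂ _ n₂∈ w (inj₁ refl) v br = aⁿbᴹa-rich a b a≢b n₂∈ n₁ v br
lemma4p19 a b a≢b n₁ n₂ _ n₂∈ w (inj₂ refl) v br =
  Rich-reverse v (aⁿbᴹa-rich a b a≢b n₂∈ n₁ (reverse v) (InBR-reverse (subst (λ w → InBR w v) (sym reversed) br)))
  where
  reversed : reverse (replicate n₁ a ++ replicate n₂ b ++ a ∷ []) ≡ a ∷ replicate n₂ b ++ replicate n₁ a
  reversed = trans (reverse-++₃ (replicate n₁ a) (replicate n₂ b) (a ∷ []))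
               (cong₂ (λ x y → a ∷ x ++ y) (reverse-replicate b n₂) (reverse-replicate a n₁))
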